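{- Consider an execution of the DRL transition system. Let $S$ be a set of actors that is closed at time $t_f$ and all of whose actors are terminated at time $t_f$. If every actor in $S$ took a snapshot sometime after its final action, then the resulting set of snapshots $Q$ (mapping each $A\in S$ to its snapshot) is consistent at $t_f$.
   Context: DRL transition system. Refobs are triples $x: A\to B$ (token $x$, owner $A$, target $B$). Facts: $\mathrm{Created}(x)$, $\mathrm{Released}(x)$, $\mathrm{CreatedUsing}(x,y)$, $\mathrm{Activated}(x)$, $\mathrm{Unreleased}(x)$, $\mathrm{SentCount}(x,n)$, $\mathrm{RecvCount}(x,n)$. A knowledge set $\Phi$ is a finite set of facts; $\Phi\vdash\varphi$ means derivability in first-order logic plus: if no $\mathrm{SentCount}(x,n)\in\Phi$ then $\Phi\vdash\mathrm{SentCount}(x,0)$; likewise for $\mathrm{RecvCount}$; $\Phi\vdash\mathrm{Created}(x)\wedge\neg\mathrm{Released}(x)$ gives $\Phi\vdash\mathrm{Unreleased}(x)$; $\Phi\vdash\mathrm{CreatedUsing}(x,y)$ gives $\Phi\vdash\mathrm{Created}(y)$. $\mathrm{IncSent}/\mathrm{IncRecv}(x,\Phi)$ increment (or create with value $1$) the corresponding count. Messages: $\mathrm{App}(x,R)$, $\mathrm{Info}(y,z,B)$, $\mathrm{Release}(x,n)$. A configuration $(\alpha,\mu,\rho,\chi)$: $\alpha$ maps internal actors to busy $[\Phi]$ or idle $(\Phi)$ states; $\mu$ gives undelivered messages of each actor; receptionists $\rho\subseteq\mathrm{dom}(\alpha)$; external actors $\chi$. Initial configuration: one busy actor $A$ with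 $\{\mathrm{Activated}(x:A\to E),\mathrm{Created}(y:A\to A),\mathrm{Activated}(y:A\to A)\}$, no messages, $\rho=\emptyset$, $\chi=\{E\}$. Events: Spawn$(x,A,B)$: busy $A$, fresh $x,y,B$; $A$ adds $\mathrm{Activated}(x:A\to B)$; new busy $B$ with $\{\mathrm{Created}(x:A\to B),\mathrm{Created}(y:B\to B),\mathrm{Activated}(y:B\to B)\}$. Send$(x,\vec y,\vec z,A,B,\vec C)$: busy $A$ with $\Phi\vdash\mathrm{Activated}(x:A\to B)$ and $\Phi\vdash\mathrm{Activated}(y_i:A\to C_i)$, fresh $z_i$; $A$'s set becomes $\mathrm{IncSent}(x,\Phi)\cup\{\mathrm{CreatedUsing}(y_i,z_i)\}$; $\mathrm{App}(x,\{z_i:B\to C_i\})$ sent to $B$. Receive$(x,B,R)$: idle $B$ consumes $\mathrm{App}(x,R)$, becomes busy with $\mathrm{IncRecv}(x,\Phi)\cup\{\mathrm{Activated}(z):z\in R\}$. Idle$(A)$: busy $A$ becomes idle. SendInfo$(y,z,A,B,C)$: busy $A$ containing $\mathrm{CreatedUsing}(y:A\to C,z:B\to C)$ removes it, increments send count of $y$, sends $\mathrm{Info}(y,z,B)$ to $C$. Info$(y,z,B,C)$: idle $C$ consumes it, stays idle with $\mathrm{IncRecv}(y,\Phi)\cup\{\mathrm{Created}(z:B\to C)\}$. SendRelease$(x,A,B)$: busy $A$ with set $\Phi\cup\{\mathrm{Activated}(x:A\to B),\mathrm{SentCount}(x,n)\}$, no $\mathrm{CreatedUsing}(x,y)\in\Phi$: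 set becomes $\Phi$ ($x$ deactivated); sends $\mathrm{Release}(x,n)$ to $B$. Release$(x,A,B)$: idle $B$ consumes $\mathrm{Release}(x,n)$ only if $\Phi\vdash\mathrm{RecvCount}(x,n)$; adds $\mathrm{Released}(x)$; $x$ is released. Compaction$(x,B,C)$: idle $C$ containing $\mathrm{Created}(x:B\to C),\mathrm{Released}(x)$ removes them and any $\mathrm{RecvCount}(x,n)$. Snapshot$(A,\Phi)$: idle $A$; no change; records $\Phi$ as $A$'s snapshot. In$(x,A,R)$: $A\in\rho$ receives from outside $\mathrm{App}(x,R)$ with fresh refobs owned by $A$ whose internal targets lie in $\rho$; external targets join $\chi$. Out$(x,B,R)$: $B\in\chi$ consumes $\mathrm{App}(x,R)$; internal targets of $R$ join $\rho$. ReleaseOut/InfoOut: Release/Info messages to external actors are dropped. An execution is $\kappa_0\to\kappa_1\to\cdots$ from the initial configuration; the event producing $\kappa_t$ occurs at time $t$; $\alpha_t$ is the first component of $\kappa_t$. A refob is unreleased once created until its target performs Release for it. An actor $A$ can potentially receive a message in $\kappa$ if some finite sequence of events from $\kappa$ leads to a configuration where $A$ has an undelivered message; $A$ is terminated at time $t$ if it is idle in $\kappa_t$ and cannot potentially receive a message in $\kappa_t$. A set $S$ of actors is closed at time $t$ if whenever $B\in S$ and a refob $x:A\to B$ is unreleased at time $t$, also $A\in S$. The final action of a terminated actor is the last non-Snapshot event it performs before becoming terminated. A set of snapshots $Q$ maps actors to knowledge sets recorded by their Snapshot events (at most one per actor); $Q$ is consistent at time $t$ if for all facts $\varphi$ and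 all $A\in\mathrm{dom}(Q)$, $Q(A)\vdash\varphi$ iff $\alpha_t(A)\vdash\varphi$. -}

module Defs where

open import Data.Nat using (ℕ; zero; suc; _≤_; _<_; _≡ᵇ_)
open import Data.Bool using (Bool; true; false; _∧_; not; if_then_else_)
open import Data.Maybe using (Maybe; just; nothing; is-nothing; is-just)
open import Data.List using (List; []; _∷_; _++_; map; concatMap; filterᵇ)
open import Data.List.Membership.Propositional using (_∈_; _∉_)
open import Data.List.Relation.Unary.All using (All)
open import Data.List.Relation.Unary.Unique.Propositional using (Unique)
open import Data.Product using (Σ; ∃; _×_; _,_; proj₁; proj₂)
open import Data.Sum using (_⊎_)
open import Data.Empty using (⊥)
open import Relation.Nullary using (¬_)
open import Relation.Binary.PropositionalEquality using (_≡_; _≢_)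

-- Names.  Tokens and actor names are drawn from one namespace ℕ
-- (freshness is checked against all names occurring anywhere).

Name : Set
Name = ℕ

Token : Set
Token = ℕ

-- A refob  x : A → B  is the triple (token x , owner A , target B).
Refob : Set
Refob = Token × Name × Name

ref : Token → Name → Name → Refob
ref x A B = x , A , B

token : Refob → Token
token r = proj₁ r

owner : Refob → Name
owner r = proj₁ (proj₂ r)

target : Refob → Name
target r = proj₂ (proj₂ r)

_==R_ : Refob → Refob → Bool
(x , a , b) ==R (y , c , d) = (x ≡ᵇ y) ∧ ((a ≡ᵇ c) ∧ (b ≡ᵇ d))

data Fact : Set where
  Created      : Refob → Fact
  Released     : Refob → Fact
  CreatedUsing : Refob → Refob → Fact
  Activated    : Refob → Fact
  Unreleased   : Refob → Fact
  SentCount    : Refob → ℕ → Fact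
  RecvCount    : Refob → ℕ → Fact

KSet : Set
KSet = List Fact

data _⊢₀_ (Φ : KSet) : Fact → Set where
  hyp       : ∀ {φ} → φ ∈ Φ → Φ ⊢₀ φ
  sent0     : ∀ {x} → (∀ n → SentCount x n ∉ Φ) → Φ ⊢₀ SentCount x 0
  recv0     : ∀ {x} → (∀ n → RecvCount x n ∉ Φ) → Φ ⊢₀ RecvCount x 0
  createdOf : ∀ {x y} → Φ ⊢₀ CreatedUsing x y → Φ ⊢₀ Created y

-- full derivability: adds  Created(x) ∧ ¬Released(x) ⇒ Unreleased(x)
-- (no rule has Unreleased as premise, so stratifying is exact)
data _⊢_ (Φ : KSet) : Fact → Set where
  base  : ∀ {φ} → Φ ⊢₀ φ → Φ ⊢ φ
  unrel : ∀ {x} → Φ ⊢₀ Created x → ¬ (Φ ⊢₀ Released x) → Φ ⊢ Unreleased x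

incSent : Refob → KSet → KSet
incSent x [] = SentCount x 1 ∷ []
incSent x (SentCount y n ∷ Φ) =
  if x ==R y then SentCount y (suc n) ∷ Φ else SentCount y n ∷ incSent x Φ
incSent x (φ ∷ Φ) = φ ∷ incSent x Φ

incRecv : Refob → KSet → KSet
incRecv x [] = RecvCount x 1 ∷ []
incRecv x (RecvCount y n ∷ Φ) =
  if x ==R y then RecvCount y (suc n) ∷ Φ else RecvCount y n ∷ incRecv x Φ
incRecv x (φ ∷ Φ) = φ ∷ incRecv x Φ

remove : (Fact → Bool) → KSet → KSet
remove p = filterᵇ (λ φ → not (p φ))

isCU : Refob → Refob → Fact → Bool
isCU y z (CreatedUsing y' z') = (y ==R y') ∧ (z ==R z')
isCU y z _ = false

isActSent : Refob → Fact → Bool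
isActSent x (Activated x')   = x ==R x'
isActSent x (SentCount x' _) = x ==R x'
isActSent x _ = false

isCompact : Refob → Fact → Bool
isCompact x (Created x')     = x ==R x'
isCompact x (Released x')    = x ==R x'
isCompact x (RecvCount x' _) = x ==R x'
isCompact x _ = false

data Msg : Set where
  App     : Refob → List Refob → Msg
  Info    : Refob → Refob → Name → Msg
  Release : Refob → ℕ → Msg

data State : Set where
  busy : KSet → State
  idle : KSet → State

knowledge : State → KSet
knowledge (busy Φ) = Φ
knowledge (idle Φ) = Φ

-- (α, μ, ρ, χ); μ is the multiset of undelivered messages, each tagged
-- with its destination actor.
record Config : Set where
  constructor conf
  field
    α : Name → Maybe State
    μ : List (Name × Msg)
    ρ : List Name
    χ : List Name
open Config public

update : (Name → Maybe State) → Name → State → Name → Maybe State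
update f A s n = if n ≡ᵇ A then just s else f n

setα : Config → Name → State → Config
setα κ A s = record κ { α = update (α κ) A s }

actor₀ external₀ x₀ y₀ : Name
actor₀ = 0
external₀ = 1
x₀ = 2
y₀ = 3

κinit : Config
κinit = conf
  (update (λ _ → nothing) actor₀
    (busy (Activated (ref x₀ actor₀ external₀) ∷ Created (ref y₀ actor₀ actor₀)
           ∷ Activated (ref y₀ actor₀ actor₀) ∷ [])))
  [] [] (external₀ ∷ [])

namesR : Refob → List Name
namesR (x , A , B) = x ∷ A ∷ B ∷ []

namesF : Fact → List Name
namesF (Created x)        = namesR x
namesF (Released x)       = namesR x
namesF (CreatedUsing x y) = namesR x ++ namesR y
namesF (Activated x)      = namesR x
namesF (Unreleased x)     = namesR x
namesF (SentCount x _)    = namesR x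
namesF (RecvCount x _)    = namesR x

namesM : Msg → List Name
namesM (App x R)      = namesR x ++ concatMap namesR R
namesM (Info y z B)   = namesR y ++ namesR z ++ (B ∷ [])
namesM (Release x _)  = namesR x

data Occurs (n : Name) (κ : Config) : Set where
  inDom   : ∀ {s} → α κ n ≡ just s → Occurs n κ
  inState : ∀ {A s φ} → α κ A ≡ just s → φ ∈ knowledge s → n ∈ namesF φ → Occurs n κ
  inMsgTo : ∀ {m} → (n , m) ∈ μ κ → Occurs n κ
  inMsg   : ∀ {B m} → (B , m) ∈ μ κ → n ∈ namesM m → Occurs n κ
  inρ     : n ∈ ρ κ → Occurs n κ
  inχ     : n ∈ χ κ → Occurs n κ

data Event : Set where
  spawnE       : Token → Token → Name → Name → Event          -- Spawn(x,A,B), y = self refob of B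
  sendE        : Token → Name → Name → List (Token × Token × Name) → Event
                 -- Send(x, ys, zs, A, B, Cs), triples (yᵢ , zᵢ , Cᵢ)
  receiveE     : Refob → Name → List Refob → Event
  idleE        : Name → Event
  sendInfoE    : Token → Token → Name → Name → Name → Event
  infoE        : Refob → Refob → Name → Name → Event
  sendReleaseE : Refob → ℕ → Event                           -- SendRelease(x,A,B), x : A → B
  releaseE     : Refob → ℕ → Event                           -- Release(x,A,B), x : A → B
  compactionE  : Refob → Event                               -- Compaction(x,B,C), x : B → C
  snapshotE    : Name → KSet → Event
  inE          : Refob → Name → List Refob → Event
  outE         : Refob → Name → List Refob → Event
  releaseOutE  : Name → Refob → ℕ → Event
  infoOutE     : Name → Refob → Refob → Name → Event

sentRefs : Name → Name → List (Token × Token × Name) → List Refob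
sentRefs A B = map (λ t → ref (proj₁ (proj₂ t)) B (proj₂ (proj₂ t)))

cuFacts : Name → Name → List (Token × Token × Name) → KSet
cuFacts A B = map (λ t → CreatedUsing (ref (proj₁ t) A (proj₂ (proj₂ t)))
                                      (ref (proj₁ (proj₂ t)) B (proj₂ (proj₂ t))))

externalTargets : (Name → Maybe State) → List Refob → List Name
externalTargets f R = map target (filterᵇ (λ r → is-nothing (f (target r))) R)

internalTargets : (Name → Maybe State) → List Refob → List Name
internalTargets f R = map target (filterᵇ (λ r → is-just (f (target r))) R)

-- one transition; `used` = names already used (freshness)
data Step (used : Name → Set) (κ : Config) : Event → Config → Set where
  spawn : ∀ {x y A B Φ} → α κ A ≡ just (busy Φ) →
    ¬ used x → ¬ used y → ¬ used B → x ≢ y → x ≢ B → y ≢ B →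
    Step used κ (spawnE x y A B)
      (setα (setα κ A (busy (Activated (ref x A B) ∷ Φ))) B
        (busy (Created (ref x A B) ∷ Created (ref y B B) ∷ Activated (ref y B B) ∷ [])))
  send : ∀ {x A B Φ} {L : List (Token × Token × Name)} → α κ A ≡ just (busy Φ) →
    Φ ⊢ Activated (ref x A B) →
    All (λ t → Φ ⊢ Activated (ref (proj₁ t) A (proj₂ (proj₂ t)))) L →
    All (λ t → ¬ used (proj₁ (proj₂ t))) L →
    Unique (map (λ t → proj₁ (proj₂ t)) L) →
    Step used κ (sendE x A B L)
      (record (setα κ A (busy (incSent (ref x A B) Φ ++ cuFacts A B L)))
        { μ = (B , App (ref x A B) (sentRefs A B L)) ∷ μ κ })
  receive : ∀ {x B R Φ pre post} → α κ B ≡ just (idle Φ) →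
    μ κ ≡ pre ++ (B , App x R) ∷ post →
    Step used κ (receiveE x B R)
      (record (setα κ B (busy (incRecv x Φ ++ map Activated R))) { μ = pre ++ post })
  idleS : ∀ {A Φ} → α κ A ≡ just (busy Φ) →
    Step used κ (idleE A) (setα κ A (idle Φ))
  sendInfo : ∀ {y z A B C Φ} → α κ A ≡ just (busy Φ) →
    CreatedUsing (ref y A C) (ref z B C) ∈ Φ →
    Step used κ (sendInfoE y z A B C)
      (record (setα κ A (busy (incSent (ref y A C)
                                 (remove (isCU (ref y A C) (ref z B C)) Φ))))
        { μ = (C , Info (ref y A C) (ref z B C) B) ∷ μ κ })
  info : ∀ {y z B C Φ pre post} → α κ C ≡ just (idle Φ) →
    μ κ ≡ pre ++ (C , Info y z B) ∷ post →
    Step used κ (infoE y z B C)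
      (record (setα κ C (idle (incRecv y Φ ++ Created z ∷ []))) { μ = pre ++ post })
  sendRelease : ∀ {x A B n Φ} → α κ A ≡ just (busy Φ) →
    Activated (ref x A B) ∈ Φ → Φ ⊢ SentCount (ref x A B) n →
    (∀ w → CreatedUsing (ref x A B) w ∉ Φ) →
    Step used κ (sendReleaseE (ref x A B) n)
      (record (setα κ A (busy (remove (isActSent (ref x A B)) Φ)))
        { μ = (B , Release (ref x A B) n) ∷ μ κ })
  release : ∀ {x A B n Φ pre post} → α κ B ≡ just (idle Φ) →
    μ κ ≡ pre ++ (B , Release (ref x A B) n) ∷ post →
    Φ ⊢ RecvCount (ref x A B) n →
    Step used κ (releaseE (ref x A B) n)
      (record (setα κ B (idle (Released (ref x A B) ∷ Φ))) { μ = pre ++ post })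
  compaction : ∀ {x B C Φ} → α κ C ≡ just (idle Φ) →
    Created (ref x B C) ∈ Φ → Released (ref x B C) ∈ Φ →
    Step used κ (compactionE (ref x B C)) (setα κ C (idle (remove (isCompact (ref x B C)) Φ)))
  snapshot : ∀ {A Φ} → α κ A ≡ just (idle Φ) →
    Step used κ (snapshotE A Φ) κ
  inS : ∀ {x A R} → A ∈ ρ κ → target x ≡ A → α κ (owner x) ≡ nothing →
    All (λ r → owner r ≡ A) R →
    All (λ r → ¬ used (token r)) R → Unique (map token R) →
    All (λ r → target r ∈ ρ κ ⊎ α κ (target r) ≡ nothing) R →
    Step used κ (inE x A R)
      (record κ { μ = (A , App x R) ∷ μ κ ; χ = externalTargets (α κ) R ++ χ κ })
  outS : ∀ {x B R pre post} → B ∈ χ κ →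
    μ κ ≡ pre ++ (B , App x R) ∷ post →
    Step used κ (outE x B R)
      (record κ { μ = pre ++ post ; ρ = internalTargets (α κ) R ++ ρ κ })
  releaseOut : ∀ {B x n pre post} → B ∈ χ κ →
    μ κ ≡ pre ++ (B , Release x n) ∷ post →
    Step used κ (releaseOutE B x n) (record κ { μ = pre ++ post })
  infoOut : ∀ {B y z C pre post} → B ∈ χ κ →
    μ κ ≡ pre ++ (B , Info y z C) ∷ post →
    Step used κ (infoOutE B y z C) (record κ { μ = pre ++ post })

data NonSnapshotActionOf : Event → Name → Set where
  bySpawn       : ∀ {x y A B} → NonSnapshotActionOf (spawnE x y A B) A
  bySend        : ∀ {x A B L} → NonSnapshotActionOf (sendE x A B L) A
  byReceive     : ∀ {x B R} → NonSnapshotActionOf (receiveE x B R) B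
  byIdle        : ∀ {A} → NonSnapshotActionOf (idleE A) A
  bySendInfo    : ∀ {y z A B C} → NonSnapshotActionOf (sendInfoE y z A B C) A
  byInfo        : ∀ {y z B C} → NonSnapshotActionOf (infoE y z B C) C
  bySendRelease : ∀ {x n} → NonSnapshotActionOf (sendReleaseE x n) (owner x)
  byRelease     : ∀ {x n} → NonSnapshotActionOf (releaseE x n) (target x)
  byCompaction  : ∀ {x} → NonSnapshotActionOf (compactionE x) (target x)

data CreatedBy : Event → Refob → Set where
  crSpawnX : ∀ {x y A B} → CreatedBy (spawnE x y A B) (ref x A B)
  crSpawnY : ∀ {x y A B} → CreatedBy (spawnE x y A B) (ref y B B)
  crSend   : ∀ {x A B L r} → r ∈ sentRefs A B L → CreatedBy (sendE x A B L) r
  crIn     : ∀ {x A R r} → r ∈ R → CreatedBy (inE x A R) r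

data InitialRefob : Refob → Set where
  initX : InitialRefob (ref x₀ actor₀ external₀)
  initY : InitialRefob (ref y₀ actor₀ actor₀)

data Reach (used : Name → Set) (κ : Config) : Config → Set where
  done : Reach used κ κ
  step : ∀ {e κ₁ κ'} → Step used κ e κ₁ →
         Reach (λ n → used n ⊎ Occurs n κ₁) κ₁ κ' → Reach used κ κ'

HasUndelivered : Config → Name → Set
HasUndelivered κ A = Σ Msg λ m → (A , m) ∈ μ κ

CanPotentiallyReceive : (Name → Set) → Config → Name → Set
CanPotentiallyReceive used κ A = Σ Config λ κ' → Reach used κ κ' × HasUndelivered κ' A

-- Executions: κ 0 = initial; ev (suc t) is the event producing κ (suc t)

record Execution : Set where
  field
    κ     : ℕ → Config
    ev    : ℕ → Event
    len   : ℕ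
    init  : κ 0 ≡ κinit
  Used : ℕ → Name → Set
  Used t n = Σ ℕ λ s → s ≤ t × Occurs n (κ s)
  field
    steps : ∀ t → t < len → Step (Used t) (κ t) (ev (suc t)) (κ (suc t))

module _ (E : Execution) where
  open Execution E

  αₜ : ℕ → Name → Maybe State
  αₜ t = α (κ t)

  UnreleasedAt : Refob → ℕ → Set
  UnreleasedAt r t =
    (InitialRefob r ⊎ Σ ℕ λ s → suc s ≤ t × CreatedBy (ev (suc s)) r) ×
    (∀ s n → suc s ≤ t → ev (suc s) ≢ releaseE r n)

  TerminatedAt : Name → ℕ → Set
  TerminatedAt A t =
    (Σ KSet λ Φ → αₜ t A ≡ just (idle Φ)) × ¬ CanPotentiallyReceive (Used t) (κ t) A

  ClosedAt : (Name → Set) → ℕ → Set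
  ClosedAt S t = ∀ r → S (target r) → UnreleasedAt r t → S (owner r)

  SnapshotAfterFinalAction : Name → KSet → ℕ → Set
  SnapshotAfterFinalAction A Φ t =
    Σ ℕ λ s → suc s ≤ t × ev (suc s) ≡ snapshotE A Φ ×
      (∀ s' → suc s < s' → s' ≤ t → ¬ NonSnapshotActionOf (ev s') A)

  ConsistentAt : (Name → Set) → (Name → KSet) → ℕ → Set
  ConsistentAt S Q t = ∀ A st φ → S A → αₜ t A ≡ just st →
    (Q A ⊢ φ → knowledge st ⊢ φ) × (knowledge st ⊢ φ → Q A ⊢ φ)

{-# OPTIONS --safe #-}
-- An actor's state changes only through its own non-Snapshot events, so after
-- the snapshot the state of A stays exactly the idle state it recorded, up to
-- time tf.  The snapshot and the current state are then literally the same
-- knowledge set.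
module Submission where

open import Defs
open import Data.Nat using (ℕ; suc; _≤_; _<_; _≤′_; ≤′-refl; ≤′-step; s≤s; _≡ᵇ_)
open import Data.Nat.Properties using (≡ᵇ⇒≡; ≤-refl; ≤-trans; ≤′⇒≤; ≤⇒≤′; n≤1+n)
open import Data.Bool using (true; false; T)
open import Data.Maybe using (Maybe; just)
open import Data.Maybe.Properties using (just-injective)
open import Data.Product using (_,_)
open import Data.Empty using (⊥-elim)
open import Function using (id)
open import Relation.Nullary using (¬_)
open import Relation.Binary.PropositionalEquality

update-≢ : (f : Name → Maybe State) (X : Name) (s : State) {A : Name} →
  A ≢ X → update f X s A ≡ f A
update-≢ f X s {A} A≢X with A ≡ᵇ X in eq
... | true  = ⊥-elim (A≢X (≡ᵇ⇒≡ A X (subst T (sym eq) _)))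
... | false = refl

-- A must be already used so that it cannot be the freshly spawned actor.
step-preserves-state : ∀ {used κ e κ' A} → Step used κ e κ' →
  ¬ NonSnapshotActionOf e A → used A → α κ' A ≡ α κ A
step-preserves-state {κ = κ} (spawn {A = X} {B = B} _ _ _ B-fresh _ _ _) ¬act usedA =
  trans (update-≢ (update (α κ) X _) B _ (λ { refl → B-fresh usedA }))
        (update-≢ (α κ) X _ (λ { refl → ¬act bySpawn }))
step-preserves-state {κ = κ} (send {A = X} _ _ _ _ _) ¬act _ =
  update-≢ (α κ) X _ (λ { refl → ¬act bySend })
step-preserves-state {κ = κ} (receive {B = X} _ _) ¬act _ =
  update-≢ (α κ) X _ (λ { refl → ¬act byReceive })
step-preserves-state {κ = κ} (idleS {A = X} _) ¬act _ =
  update-≢ (α κ) X _ (λ { refl → ¬act byIdle })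
step-preserves-state {κ = κ} (sendInfo {A = X} _ _) ¬act _ =
  update-≢ (α κ) X _ (λ { refl → ¬act bySendInfo })
step-preserves-state {κ = κ} (info {C = X} _ _) ¬act _ =
  update-≢ (α κ) X _ (λ { refl → ¬act byInfo })
step-preserves-state {κ = κ} (sendRelease {A = X} _ _ _ _) ¬act _ =
  update-≢ (α κ) X _ (λ { refl → ¬act bySendRelease })
step-preserves-state {κ = κ} (release {B = X} _ _ _) ¬act _ =
  update-≢ (α κ) X _ (λ { refl → ¬act byRelease })
step-preserves-state {κ = κ} (compaction {C = X} _ _ _) ¬act _ =
  update-≢ (α κ) X _ (λ { refl → ¬act byCompaction })
step-preserves-state (snapshot _)            _ _ = refl
step-preserves-state (inS _ _ _ _ _ _ _)     _ _ = refl
step-preserves-state (outS _ _)              _ _ = refl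
step-preserves-state (releaseOut _ _)        _ _ = refl
step-preserves-state (infoOut _ _)           _ _ = refl

snapshot-records-state : ∀ {used κ κ' A Φ} → Step used κ (snapshotE A Φ) κ' →
  α κ' A ≡ just (idle Φ)
snapshot-records-state (snapshot α-A) = α-A

module _ (E : Execution) where
  open Execution E

  snapshot-state : ∀ {s A Φ} → suc s ≤ len → ev (suc s) ≡ snapshotE A Φ →
    α (κ (suc s)) A ≡ just (idle Φ)
  snapshot-state {s} s<len ev≡snapshot =
    snapshot-records-state (subst (λ e → Step _ (κ s) e (κ (suc s))) ev≡snapshot (steps s s<len))

  state-stable : ∀ {t t' A st} → t ≤′ t' → t' ≤ len →
    (∀ s' → t < s' → s' ≤ t' → ¬ NonSnapshotActionOf (ev s') A) →
    α (κ t) A ≡ just st → α (κ t') A ≡ just st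
  state-stable ≤′-refl _ _ α-A = α-A
  state-stable {t' = suc n} (≤′-step t≤n) n<len quiet α-A =
    trans (step-preserves-state (steps n n<len)
             (quiet (suc n) (s≤s (≤′⇒≤ t≤n)) ≤-refl) (n , ≤-refl , inDom α-n))
          α-n
    where
    α-n = state-stable t≤n (≤-trans (n≤1+n n) n<len)
            (λ s' t<s' s'≤n → quiet s' t<s' (≤-trans s'≤n (n≤1+n n))) α-A

lemma6p2 : (E : Execution) (S : Name → Set) (Q : Name → KSet) (tf : ℕ) →
    tf ≤ Execution.len E →
    ClosedAt E S tf →
    (∀ A → S A → TerminatedAt E A tf) →
    (∀ A → S A → SnapshotAfterFinalAction E A (Q A) tf) →
    ConsistentAt E S Q tf
lemma6p2 E S Q tf tf≤len _ _ snap A st φ SA α-A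
  with snap A SA
... | s , s<tf , ev≡snapshot , quiet
  with just-injective (trans (sym α-A) α-A-at-tf)
  where
  α-A-at-tf : α (Execution.κ E tf) A ≡ just (idle (Q A))
  α-A-at-tf = state-stable E (≤⇒≤′ s<tf) tf≤len quiet
                (snapshot-state E (≤-trans s<tf tf≤len) ev≡snapshot)
... | refl = id , id
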